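{- Let $n,k_1,k_2,t$ be positive integers with $k_1\geq k_2\geq t+1$ and $n\geq\max\{t+1,k_2-t\}\cdot(t+1)(k_1-t+1)(k_2-t+1)+t+1$. If $k_2\geq 2t+1$, then $g_1(k_1,k_2,n,t)>g_2(k_1,k_2,n,t)$.
   Context: Binomial coefficients $\binom{a}{b}$ are $0$ when $b<0$ or $b>a$. $g_1(k,\ell,n,t)=\left(\binom{n-t}{k-t}-\binom{n-\ell-1}{k-t}\right)\left(\binom{n-t}{\ell-t}+t\right)$, $g_2(k,\ell,n,t)=\binom{n-t-1}{k-t-1}\left((t+1)\binom{n-t-1}{\ell-t}+\binom{n-t-1}{\ell-t-1}\right)$. -}

module Defs where

open import Data.Nat using (ℕ; _⊔_)
open import Data.Nat.Combinatorics using (_C_)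
open import Data.Integer using (ℤ; +_; -[1+_]; _+_; _-_; _*_)

-- Binomial coefficient with integer arguments: 0 when b < 0 or b > a
-- (in particular 0 when a < 0 and b ≥ 0); stdlib's n C k is 0 for k > n.
binom : ℤ → ℤ → ℤ
binom (+ a) (+ b) = + (a C b)
binom (+ a) -[1+ b ] = + 0
binom -[1+ a ] _ = + 0

g₁ : ℤ → ℤ → ℤ → ℤ → ℤ
g₁ k ℓ n t =
  (binom (n - t) (k - t) - binom (n - ℓ - + 1) (k - t))
  * (binom (n - t) (ℓ - t) + t)

g₂ : ℤ → ℤ → ℤ → ℤ → ℤ
g₂ k ℓ n t =
  binom (n - t - + 1) (k - t - + 1)
  * ((t + + 1) * binom (n - t - + 1) (ℓ - t) + binom (n - t - + 1) (ℓ - t - + 1))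

-- Write m = n − t − 1, a = k₁ − t, b = k₂ − t and P = n − k₂ − 1, so m = b + P. By the hockey
-- stick identity C(m+1,a) − C(P,a) = Σ_{P≤i≤m} C(i,a−1) ≥ C(m,a−1) + b·C(P,a−1), and the
-- bound on n forces t·C(m,a−1) ≤ (t+1)·C(P,a−1) ≤ b·C(P,a−1). Hence the first factor of g₁
-- is at least (t+1)·C(m,a−1), while g₂ = C(m,a−1)((t+1)C(m,b) + C(m,b−1)) ≤ (t+1)·C(m,a−1)·C(m+1,b);
-- the second factor of g₁ is C(m+1,b) + t, and the extra t makes the inequality strict.

module Submission where

open import Defs
open import Data.Nat using (ℕ; _≤_; _⊔_; _+_; _*_; _∸_)
open import Data.Integer using (+_) renaming (_<_ to _<ℤ_)

open import Data.Nat using (suc; zero; _<_; s≤s; z≤n; >-nonZero)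
open import Data.Nat.Properties
open import Data.Nat.Combinatorics using (_C_; nC1≡n; nCk+nC[k+1]≡[n+1]C[k+1])
open import Data.Nat.Tactic.RingSolver using (solve-∀)
open import Data.Integer using (_-_; +<+) renaming (_+_ to _+ℤ_; _*_ to _*ℤ_)
import Data.Integer.Properties as ℤ
open import Data.Product using (∃-syntax; _,_)
open import Data.Sum using (inj₁; inj₂)
open import Relation.Binary.PropositionalEquality

[1+n]C[1+k]≡nCk+nC[1+k] : ∀ n k → suc n C suc k ≡ n C k + n C suc k
[1+n]C[1+k]≡nCk+nC[1+k] n k = sym (nCk+nC[k+1]≡[n+1]C[k+1] n k)

nCk≤[1+n]Ck : ∀ n k → n C k ≤ suc n C k
nCk≤[1+n]Ck n zero    = ≤-refl
nCk≤[1+n]Ck n (suc k) =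
  subst (n C suc k ≤_) (sym ([1+n]C[1+k]≡nCk+nC[1+k] n k)) (m≤n+m _ _)

m≤n⇒mCk≤nCk : ∀ {m n} k → m ≤ n → m C k ≤ n C k
m≤n⇒mCk≤nCk {n = zero}  k z≤n = ≤-refl
m≤n⇒mCk≤nCk {n = suc n} k m≤1+n with m≤n⇒m<n∨m≡n m≤1+n
... | inj₁ (s≤s m≤n) = ≤-trans (m≤n⇒mCk≤nCk k m≤n) (nCk≤[1+n]Ck n k)
... | inj₂ refl      = ≤-refl

k≤n⇒nCk>0 : ∀ {n k} → k ≤ n → 0 < n C k
k≤n⇒nCk>0 {n}     {zero}  _         = s≤s z≤n
k≤n⇒nCk>0 {suc n} {suc k} (s≤s k≤n) =
  subst (0 <_) (sym ([1+n]C[1+k]≡nCk+nC[1+k] n k)) (≤-trans (k≤n⇒nCk>0 k≤n) (m≤m+n _ _))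

[1+k]*[1+n]C[1+k]≡[1+n]*nCk : ∀ n k → suc k * (suc n C suc k) ≡ suc n * (n C k)
[1+k]*[1+n]C[1+k]≡[1+n]*nCk zero    zero    = refl
[1+k]*[1+n]C[1+k]≡[1+n]*nCk zero    (suc k) = *-zeroʳ (suc (suc k))
[1+k]*[1+n]C[1+k]≡[1+n]*nCk (suc n) zero    =
  trans (*-identityˡ _) (trans (nC1≡n (suc (suc n))) (sym (*-identityʳ _)))
[1+k]*[1+n]C[1+k]≡[1+n]*nCk (suc n) (suc k) = begin
  suc (suc k) * (suc (suc n) C suc (suc k))
    ≡⟨ cong (suc (suc k) *_) ([1+n]C[1+k]≡nCk+nC[1+k] (suc n) (suc k)) ⟩
  suc (suc k) * (A + B)
    ≡⟨ regroup k A B ⟩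
  A + (suc k * A + suc (suc k) * B)
    ≡⟨ cong₂ (λ x y → A + (x + y)) ([1+k]*[1+n]C[1+k]≡[1+n]*nCk n k) ([1+k]*[1+n]C[1+k]≡[1+n]*nCk n (suc k)) ⟩
  A + (suc n * (n C k) + suc n * (n C suc k))
    ≡⟨ cong (λ x → A + x) (sym (*-distribˡ-+ (suc n) (n C k) (n C suc k))) ⟩
  A + suc n * (n C k + n C suc k)
    ≡⟨ cong (λ x → A + suc n * x) (sym ([1+n]C[1+k]≡nCk+nC[1+k] n k)) ⟩
  suc (suc n) * A ∎
  where
  open ≡-Reasoning
  A = suc n C suc k
  B = suc n C suc (suc k)
  regroup : ∀ k A B → suc (suc k) * (A + B) ≡ A + (suc k * A + suc (suc k) * B)
  regroup = solve-∀

hockeyStick-lowerBound : ∀ s P r → (s + P) C r + s * (P C r) + P C suc r ≤ suc (s + P) C suc r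
hockeyStick-lowerBound zero P r = ≤-reflexive (begin
  P C r + 0 + P C suc r ≡⟨ cong (_+ P C suc r) (+-identityʳ (P C r)) ⟩
  P C r + P C suc r     ≡⟨ nCk+nC[k+1]≡[n+1]C[k+1] P r ⟩
  suc P C suc r         ∎)
  where open ≡-Reasoning
hockeyStick-lowerBound (suc s) P r = begin
  (suc s + P) C r + suc s * (P C r) + P C suc r
    ≡⟨ +-assoc ((suc s + P) C r) (suc s * (P C r)) (P C suc r) ⟩
  (suc s + P) C r + (P C r + s * (P C r) + P C suc r)
    ≤⟨ +-monoʳ-≤ ((suc s + P) C r) (+-monoˡ-≤ (P C suc r) (+-monoˡ-≤ (s * (P C r)) (m≤n⇒mCk≤nCk r (m≤n+m P s)))) ⟩
  (suc s + P) C r + ((s + P) C r + s * (P C r) + P C suc r)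
    ≤⟨ +-monoʳ-≤ ((suc s + P) C r) (hockeyStick-lowerBound s P r) ⟩
  (suc s + P) C r + (suc s + P) C suc r
    ≡⟨ nCk+nC[k+1]≡[n+1]C[k+1] (suc s + P) r ⟩
  suc (suc s + P) C suc r ∎
  where open ≤-Reasoning

hockeyStick-upperBound : ∀ s P r → (suc s + P) C suc r ≤ P C suc r + suc s * ((s + P) C r)
hockeyStick-upperBound zero P r = ≤-reflexive (begin
  suc P C suc r           ≡⟨ [1+n]C[1+k]≡nCk+nC[1+k] P r ⟩
  P C r + P C suc r       ≡⟨ +-comm (P C r) (P C suc r) ⟩
  P C suc r + P C r       ≡⟨ cong (λ x → P C suc r + x) (sym (*-identityˡ (P C r))) ⟩
  P C suc r + 1 * (P C r) ∎)
  where open ≡-Reasoning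
hockeyStick-upperBound (suc s) P r = begin
  (suc (suc s) + P) C suc r
    ≡⟨ [1+n]C[1+k]≡nCk+nC[1+k] (suc s + P) r ⟩
  E + (suc s + P) C suc r
    ≤⟨ +-monoʳ-≤ E (hockeyStick-upperBound s P r) ⟩
  E + (P C suc r + suc s * ((s + P) C r))
    ≤⟨ +-monoʳ-≤ E (+-monoʳ-≤ (P C suc r) (*-monoʳ-≤ (suc s) (nCk≤[1+n]Ck (s + P) r))) ⟩
  E + (P C suc r + suc s * E)
    ≡⟨ regroup E (P C suc r) s ⟩
  P C suc r + suc (suc s) * E ∎
  where
  open ≤-Reasoning
  E = (suc s + P) C r
  regroup : ∀ E W s → E + (W + suc s * E) ≡ W + suc (suc s) * E
  regroup = solve-∀

-- With S = s + 1, absorption gives (1+S+tS)·C(s+P,r) ≤ C(S+P,r+1) and the upper bound gives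
-- C(S+P,r+1) ≤ C(P,r+1) + S·C(s+P,r); together t·S·C(s+P,r) ≤ C(P,r+1).
C-shift-bound : ∀ t s P R → R * (1 + suc s + t * suc s) ≤ suc s + P →
                t * ((suc s + P) C R) ≤ suc t * (P C R)
C-shift-bound t s P zero    _ = *-monoˡ-≤ 1 (n≤1+n t)
C-shift-bound t s P (suc r) R*u≤S+P = begin
  t * X             ≤⟨ *-monoʳ-≤ t (hockeyStick-upperBound s P r) ⟩
  t * (B + S * E)   ≡⟨ *-distribˡ-+ t B (S * E) ⟩
  t * B + t * (S * E) ≤⟨ +-monoʳ-≤ (t * B) tSE≤B ⟩
  t * B + B         ≡⟨ +-comm (t * B) B ⟩
  suc t * B         ∎
  where
  open ≤-Reasoning
  S = suc s
  X = (S + P) C suc r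
  B = P C suc r
  E = (s + P) C r
  u = 1 + S + t * S
  uE≤X : u * E ≤ X
  uE≤X = *-cancelˡ-≤ (suc r) (begin
    suc r * (u * E) ≡⟨ *-assoc (suc r) u E ⟨
    suc r * u * E   ≤⟨ *-monoˡ-≤ E R*u≤S+P ⟩
    (S + P) * E     ≡⟨ [1+k]*[1+n]C[1+k]≡[1+n]*nCk (s + P) r ⟨
    suc r * X       ∎)
  expand : ∀ S t E → (1 + S + t * S) * E ≡ E + t * (S * E) + S * E
  expand = solve-∀
  tSE≤B : t * (S * E) ≤ B
  tSE≤B = m+n≤o⇒n≤o E (+-cancelʳ-≤ (S * E) _ _ (begin
    E + t * (S * E) + S * E ≡⟨ expand S t E ⟨
    u * E                   ≤⟨ uE≤X ⟩
    X                       ≤⟨ hockeyStick-upperBound s P r ⟩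
    B + S * E               ∎))

g₂<g₁-shifted-ℕ : ∀ t q R P → 1 ≤ t → t ≤ q → R * (1 + suc q + t * suc q) ≤ suc q + P →
  ((suc q + P) C R) * ((t + 1) * ((suc q + P) C suc q) + (suc q + P) C q)
    < (suc (suc q + P) C suc R ∸ P C suc R) * (suc (suc q + P) C suc q + t)
g₂<g₁-shifted-ℕ t q R P 1≤t t≤q R*u≤m = begin-strict
  X * ((t + 1) * b + a)        ≤⟨ *-monoʳ-≤ X (+-monoʳ-≤ ((t + 1) * b) (m≤n*m a (suc t))) ⟩
  X * ((t + 1) * b + suc t * a) ≡⟨ regroup X t a b ⟩
  suc t * X * (a + b)          <⟨ *-monoʳ-< (suc t * X) {{m*n≢0 (suc t) X {{_}} {{>-nonZero X>0}}}} (m<m+n (a + b) 1≤t) ⟩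
  suc t * X * (a + b + t)      ≡⟨ cong (λ c → suc t * X * (c + t)) (nCk+nC[k+1]≡[n+1]C[k+1] m q) ⟩
  suc t * X * (suc m C suc q + t) ≤⟨ *-monoˡ-≤ (suc m C suc q + t) [1+t]X≤D ⟩
  D * (suc m C suc q + t)      ∎
  where
  open ≤-Reasoning
  m = suc q + P
  X = m C R
  a = m C q
  b = m C suc q
  D = suc m C suc R ∸ P C suc R
  X>0 : 0 < X
  X>0 = k≤n⇒nCk>0 (≤-trans (m≤m*n R (1 + suc q + t * suc q)) R*u≤m)
  [1+t]X≤D : suc t * X ≤ D
  [1+t]X≤D = begin
    X + t * X          ≤⟨ +-monoʳ-≤ X (≤-trans (C-shift-bound t q P R R*u≤m) (*-monoˡ-≤ (P C R) (s≤s t≤q))) ⟩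
    X + suc q * (P C R) ≤⟨ m+n≤o⇒m≤o∸n (X + suc q * (P C R)) (hockeyStick-lowerBound (suc q) P R) ⟩
    D                  ∎
  regroup : ∀ X t a b → X * ((t + 1) * b + suc t * a) ≡ suc t * X * (a + b)
  regroup = solve-∀

n≤m⇒+m-+n≡+[m∸n] : ∀ {m n} → n ≤ m → + m - + n ≡ + (m ∸ n)
n≤m⇒+m-+n≡+[m∸n] {m} {n} n≤m = trans (ℤ.m-n≡m⊖n m n) (ℤ.⊖-≥ n≤m)

+[m+n]-+m≡+n : ∀ m n → + (m + n) - + m ≡ + n
+[m+n]-+m≡+n m n = trans (n≤m⇒+m-+n≡+[m∸n] (m≤m+n m n)) (cong +_ (m+n∸m≡n m n))

-- Parameters k₁ = t + 1 + R, k₂ = t + 1 + q, n = t + 1 + m with m = q + 1 + P, so that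
-- P = n − k₂ − 1 and all integer subtractions in g₁ and g₂ are exact.
g₁-shifted : ∀ t q R P →
  g₁ (+ (t + suc R)) (+ (t + suc q)) (+ (t + suc (suc q + P))) (+ t)
    ≡ + ((suc (suc q + P) C suc R ∸ P C suc R) * (suc (suc q + P) C suc q + t))
g₁-shifted t q R P
  rewrite +[m+n]-+m≡+n t (suc (suc q + P)) | +[m+n]-+m≡+n t (suc R) | +[m+n]-+m≡+n t (suc q)
        | trans (cong (λ x → t + suc x) (sym (+-suc q P))) (sym (+-assoc t (suc q) (suc P)))
        | +[m+n]-+m≡+n (t + suc q) (suc P) = begin
  (+ U₁ - + U₂) *ℤ (+ b +ℤ + t)
    ≡⟨ cong₂ _*ℤ_ (n≤m⇒+m-+n≡+[m∸n] U₂≤U₁) (sym (ℤ.pos-+ b t)) ⟩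
  + (U₁ ∸ U₂) *ℤ + (b + t)
    ≡⟨ ℤ.pos-* (U₁ ∸ U₂) (b + t) ⟨
  + ((U₁ ∸ U₂) * (b + t)) ∎
  where
  open ≡-Reasoning
  m = suc q + P
  U₁ = suc m C suc R
  U₂ = P C suc R
  b = suc m C suc q
  U₂≤U₁ : U₂ ≤ U₁
  U₂≤U₁ = m≤n⇒mCk≤nCk (suc R) (m≤n⇒m≤1+n (m≤n+m P (suc q)))

g₂-shifted : ∀ t q R P →
  g₂ (+ (t + suc R)) (+ (t + suc q)) (+ (t + suc (suc q + P))) (+ t)
    ≡ + (((suc q + P) C R) * ((t + 1) * ((suc q + P) C suc q) + (suc q + P) C q))
g₂-shifted t q R P
  rewrite +[m+n]-+m≡+n t (suc (suc q + P)) | +[m+n]-+m≡+n t (suc R) | +[m+n]-+m≡+n t (suc q) = begin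
  + X *ℤ ((+ t +ℤ + 1) *ℤ + b +ℤ + a) ≡⟨ cong (λ c → + X *ℤ (c *ℤ + b +ℤ + a)) (ℤ.pos-+ t 1) ⟨
  + X *ℤ (+ (t + 1) *ℤ + b +ℤ + a)    ≡⟨ cong (λ c → + X *ℤ (c +ℤ + a)) (ℤ.pos-* (t + 1) b) ⟨
  + X *ℤ (+ ((t + 1) * b) +ℤ + a)     ≡⟨ cong (+ X *ℤ_) (ℤ.pos-+ ((t + 1) * b) a) ⟨
  + X *ℤ + ((t + 1) * b + a)          ≡⟨ ℤ.pos-* X ((t + 1) * b + a) ⟨
  + (X * ((t + 1) * b + a))           ∎
  where
  open ≡-Reasoning
  X = (suc q + P) C R
  a = (suc q + P) C q
  b = (suc q + P) C suc q

m<n⇒∃[o]m+suc[o]≡n : ∀ {m n} → m < n → ∃[ o ] m + suc o ≡ n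
m<n⇒∃[o]m+suc[o]≡n {m} m<n with m≤n⇒∃[o]m+o≡n m<n
... | o , 1+m+o≡n = o , trans (+-suc m o) 1+m+o≡n

2t+1≤t+1+q⇒t≤q : ∀ {t q} → 2 * t + 1 ≤ t + suc q → t ≤ q
2t+1≤t+1+q⇒t≤q {t} {q} h = ≤-pred (+-cancelˡ-≤ t _ _ (subst (_≤ t + suc q) (double t) h))
  where
  double : ∀ t → 2 * t + 1 ≡ t + suc t
  double = solve-∀

n-bound⇒shift-condition : ∀ {t q R M} mx → 1 ≤ mx →
  mx * (t + 1) * (suc R + 1) * (suc q + 1) + t + 1 ≤ t + suc M →
  R * (1 + suc q + t * suc q) + suc q ≤ M
n-bound⇒shift-condition {t} {q} {R} {M} mx 1≤mx H = begin
  R * u + suc q                                ≤⟨ m≤m+n (R * u + suc q) slack ⟩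
  R * u + suc q + slack                        ≡⟨ expand t q R ⟩
  1 * (t + 1) * (suc R + 1) * (suc q + 1)      ≤⟨ *-monoˡ-≤ (suc q + 1) (*-monoˡ-≤ (suc R + 1) (*-monoˡ-≤ (t + 1) 1≤mx)) ⟩
  mx * (t + 1) * (suc R + 1) * (suc q + 1)     ≤⟨ ≤-pred (+-cancelˡ-≤ t _ _ (subst (_≤ t + suc M) (+-suc-comm _ t) H)) ⟩
  M                                            ∎
  where
  open ≤-Reasoning
  u = 1 + suc q + t * suc q
  slack = R * t + 2 * t * (q + 2) + q + 3
  expand : ∀ t q R → R * (1 + suc q + t * suc q) + suc q + (R * t + 2 * t * (q + 2) + q + 3)
                     ≡ 1 * (t + 1) * (suc R + 1) * (suc q + 1)
  expand = solve-∀
  +-suc-comm : ∀ Y t → Y + t + 1 ≡ t + suc Y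
  +-suc-comm = solve-∀

lemma4p2 : (n k₁ k₂ t : ℕ) → 1 ≤ n → 1 ≤ k₁ → 1 ≤ k₂ → 1 ≤ t →
    k₂ ≤ k₁ → t + 1 ≤ k₂ →
    ((t + 1) ⊔ (k₂ ∸ t)) * (t + 1) * (k₁ ∸ t + 1) * (k₂ ∸ t + 1) + t + 1 ≤ n →
    2 * t + 1 ≤ k₂ →
    g₂ (+ k₁) (+ k₂) (+ n) (+ t) <ℤ g₁ (+ k₁) (+ k₂) (+ n) (+ t)
lemma4p2 n k₁ k₂ t _ _ _ 1≤t k₂≤k₁ t+1≤k₂ H 2t+1≤k₂
  with m<n⇒∃[o]m+suc[o]≡n (≤-trans t<k₂ k₂≤k₁) | m<n⇒∃[o]m+suc[o]≡n t<k₂ | m<n⇒∃[o]m+suc[o]≡n t<n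
  where
  t<k₂ : t < k₂
  t<k₂ = subst (_≤ k₂) (+-comm t 1) t+1≤k₂
  t<n : t < n
  t<n = ≤-trans (s≤s (m≤n+m t _)) (subst (_≤ n) (+-comm _ 1) H)
... | R , refl | q , refl | M , refl
  rewrite m+n∸m≡n t (suc R) | m+n∸m≡n t (suc q)
  with bound ← n-bound⇒shift-condition ((t + 1) ⊔ suc q) (≤-trans (s≤s z≤n) (m≤n⊔m (t + 1) (suc q))) H
  with m≤n⇒∃[o]m+o≡n {suc q} (m+n≤o⇒n≤o _ bound)
... | P , refl rewrite g₁-shifted t q R P | g₂-shifted t q R P =
  +<+ (g₂<g₁-shifted-ℕ t q R P 1≤t (2t+1≤t+1+q⇒t≤q 2t+1≤k₂) (m+n≤o⇒m≤o _ bound))
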